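{- Let $A=(a_{ij})$ be an $n\times n$ $(0,1)$-matrix representing a binary relation $\rho$ on $\{1,\dots,n\}$. The relation represented by the matrix $T$ output by Algorithm 1 (described in the context) on input $A$ is a maximal transitive relation contained in $\rho$.
   Context: A matrix $A=(a_{ij})$ represents the relation $\rho=\{(i,j): a_{ij}=1\}$. A relation $\alpha$ is transitive if $(a,b),(b,c)\in\alpha$ implies $(a,c)\in\alpha$. A transitive relation $\alpha\subseteq\rho$ is a maximal transitive relation contained in $\rho$ if there is no transitive relation $\beta$ with $\alpha\subsetneq\beta\subseteq\rho$. Algorithm 1 modifies $A$ in place and returns the final matrix as $T$: for $i=1,2,\dots,n$ (in increasing order), for $j=1,2,\dots,n$ with $j\neq i$ (in increasing order), if currently $a_{ij}=1$, then for $k=1,2,\dots,n$: (a) if $k\neq j$ and currently $a_{ik}=0$, set $a_{jk}:=0$; (b) if $k\neq i$ and currently $a_{kj}=0$, set $a_{ki}:=0$. -}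

module Defs where

open import Data.Bool using (Bool; true; false; if_then_else_; _∧_)
open import Data.Fin using (Fin; _≟_)
open import Data.List using (List; foldl; allFin)
open import Data.Nat using (ℕ)
open import Data.Product using (Σ; _×_)
open import Level using (0ℓ)
open import Relation.Binary using (Rel; Transitive; _⇒_)
open import Relation.Binary.PropositionalEquality using (_≡_)
open import Relation.Nullary using (¬_)
open import Relation.Nullary.Decidable using (⌊_⌋)

Matrix : ℕ → Set
Matrix n = Fin n → Fin n → Bool

relOf : ∀ {n} → Matrix n → Rel (Fin n) 0ℓ
relOf A i j = A i j ≡ true

setEntry : ∀ {n} → Matrix n → Fin n → Fin n → Bool → Matrix n
setEntry M r c b i j = if ⌊ i ≟ r ⌋ ∧ ⌊ j ≟ c ⌋ then b else M i j

stepK : ∀ {n} → Fin n → Fin n → Matrix n → Fin n → Matrix n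
stepK i j M k = stepB (stepA M)
  where
  stepA : _ → _
  stepA M = if ⌊ k ≟ j ⌋ then M else (if M i k then M else setEntry M j k false)
  stepB : _ → _
  stepB M = if ⌊ k ≟ i ⌋ then M else (if M k j then M else setEntry M k i false)

stepJ : ∀ {n} → Fin n → Matrix n → Fin n → Matrix n
stepJ {n} i M j =
  if ⌊ j ≟ i ⌋ then M
  else (if M i j then foldl (stepK i j) M (allFin n) else M)

stepI : ∀ {n} → Matrix n → Fin n → Matrix n
stepI {n} M i = foldl (stepJ i) M (allFin n)

algorithm1 : ∀ {n} → Matrix n → Matrix n
algorithm1 {n} A = foldl stepI A (allFin n)

IsMaximalTransitiveIn : ∀ {n} → Rel (Fin n) 0ℓ → Rel (Fin n) 0ℓ → Set₁
IsMaximalTransitiveIn {n} α ρ =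
  Transitive α × (α ⇒ ρ) ×
  ¬ (Σ (Rel (Fin n) 0ℓ) λ β → Transitive β × (α ⇒ β) × ¬ (β ⇒ α) × (β ⇒ ρ))

module Submission where

-- When a_ij = 1, the k-loop for (i, j) leaves row i and column j alone and
-- replaces row j by its intersection with row i and column i by its intersection
-- with column j. Call (a, b) closed in M if M a b = 1 implies row b ⊆ row a and
-- column a ⊆ column b; closedness of every pair is transitivity. Processing (i, j)
-- closes it, and keeps every earlier processed pair closed and its entry intact,
-- because the earlier pairs form whole rows (plus part of row i). An entry is only
-- deleted on behalf of a processed pair (i, j) whose entry survives to the end, so a
-- transitive β with T ⊆ β ⊆ A contains (i, j) and, by transitivity, not the deleted entry.

open import Data.Bool using (Bool; true; false; if_then_else_)
open import Data.Bool.Properties using (not-¬)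
open import Data.Empty using (⊥; ⊥-elim)
open import Data.Fin using (Fin; _≟_)
open import Data.List using (List; []; _∷_; [_]; foldl; allFin)
open import Data.List.Membership.Propositional using (_∈_)
open import Data.List.Membership.Propositional.Properties using (∈-allFin)
open import Data.List.Relation.Unary.Any using (here; there)
open import Data.Nat using (ℕ)
open import Data.Product using (Σ; _×_; _,_; proj₁; proj₂)
open import Data.Sum using (inj₁; inj₂)
open import Function.Bundles using (_⇔_; mk⇔; Equivalence)
open import Level using (0ℓ)
open import Relation.Binary using (Rel; Transitive; _⇒_)
open import Relation.Binary.Construct.Union using (_∪_)
open import Relation.Binary.PropositionalEquality using (_≡_; _≢_; refl)
open import Relation.Nullary using (¬_; Dec; yes; no)
open import Relation.Nullary.Decidable using (⌊_⌋)
open import Relation.Unary using (_⊆_)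

open import Defs

open Equivalence using (to; from)

private
  variable
    n : ℕ
    i j : Fin n
    M K : Matrix n

adjoin : ∀ {a ℓ} {X A : Set a} → (X → Rel A ℓ) → Rel A ℓ → List X → Rel A ℓ
adjoin D = foldl (λ Q x → Q ∪ D x)

module _ {a ℓ} {X A : Set a} (D : X → Rel A ℓ) where

  adjoin-⊇ : ∀ {P} xs → P ⇒ adjoin D P xs
  adjoin-⊇ []       p = p
  adjoin-⊇ (_ ∷ xs) p = adjoin-⊇ xs (inj₁ p)

  adjoin-∈ : ∀ {P x xs} → x ∈ xs → D x ⇒ adjoin D P xs
  adjoin-∈ {xs = _ ∷ xs} (here refl) d = adjoin-⊇ xs (inj₂ d)
  adjoin-∈ (there x∈xs)              d = adjoin-∈ x∈xs d

  adjoin-⊆ : ∀ {P Q : Rel A ℓ} → P ⇒ Q → (∀ x → D x ⇒ Q) → ∀ xs → adjoin D P xs ⇒ Q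
  adjoin-⊆ P⇒Q D⇒Q []       = P⇒Q
  adjoin-⊆ {P} {Q} P⇒Q D⇒Q (x ∷ xs) = adjoin-⊆ P∪Dx⇒Q D⇒Q xs
    where
    P∪Dx⇒Q : P ∪ D x ⇒ Q
    P∪Dx⇒Q (inj₁ p) = P⇒Q p
    P∪Dx⇒Q (inj₂ d) = D⇒Q x d

-- Both halves of stepK have this shape: stepK i j M k is definitionally
-- killUnless (k ≟ i) (A k j) k i A  with  A = killUnless (k ≟ j) (M i k) j k M.
killUnless : {P : Set} → Dec P → Bool → Fin n → Fin n → Matrix n → Matrix n
killUnless d v r c N = if ⌊ d ⌋ then N else (if v then N else setEntry N r c false)

killUnless-spec : ∀ {P : Set} (d : Dec P) v (r c : Fin n) N {x y} →
  relOf (killUnless d v r c N) x y ⇔ (relOf N x y × (x ≡ r → y ≡ c → ¬ P → v ≡ true))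
killUnless-spec (yes p) v     r c N = mk⇔ (λ e → e , λ _ _ ¬p → ⊥-elim (¬p p)) proj₁
killUnless-spec (no _)  true  r c N = mk⇔ (λ e → e , λ _ _ _ → refl) proj₁
killUnless-spec (no ¬p) false r c N {x} {y} with x ≟ r | y ≟ c
... | yes refl | yes refl = mk⇔ (λ ()) (λ (_ , kept) → kept refl refl ¬p)
... | yes _    | no y≢c   = mk⇔ (λ e → e , λ _ y≡c → ⊥-elim (y≢c y≡c)) proj₁
... | no x≢r   | _        = mk⇔ (λ e → e , λ x≡r → ⊥-elim (x≢r x≡r)) proj₁

-- Given a_ij = 1, the exceptions k ≠ j and k ≠ i of the algorithm need no record here.
Pruned : List (Fin n) → Fin n → Fin n → Matrix n → Rel (Fin n) 0ℓ
Pruned ks i j M x y =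
  relOf M x y × (x ≡ j → y ∈ ks → relOf M i y) × (y ≡ i → x ∈ ks → relOf M x j)

pruned-row : ∀ {ks y} (M : Matrix n) → relOf M i j → relOf M i y → Pruned ks i j M i y
pruned-row M Mij Miy = Miy , (λ _ _ → Miy) , (λ _ _ → Mij)

pruned-col : ∀ {ks x} (M : Matrix n) → relOf M i j → relOf M x j → Pruned ks i j M x j
pruned-col M Mij Mxj = Mxj , (λ _ _ → Mij) , (λ _ _ → Mxj)

stepK-spec : relOf M i j → ∀ k {x y} → relOf (stepK i j M k) x y ⇔ Pruned [ k ] i j M x y
stepK-spec {M = M} {i} {j} Mij k {x} {y} = mk⇔ sound complete
  where
  A : Matrix _
  A = killUnless (k ≟ j) (M i k) j k M

  outer : ∀ {x y} → relOf (stepK i j M k) x y ⇔ (relOf A x y × (x ≡ k → y ≡ i → k ≢ i → relOf A k j))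
  outer = killUnless-spec (k ≟ i) (A k j) k i A

  inner : ∀ {x y} → relOf A x y ⇔ (relOf M x y × (x ≡ j → y ≡ k → k ≢ j → relOf M i k))
  inner = killUnless-spec (k ≟ j) (M i k) j k M

  cutRow : (x ≡ j → y ≡ k → k ≢ j → relOf M i k) → x ≡ j → y ∈ [ k ] → relOf M i y
  cutRow kept refl (here refl) with k ≟ j
  ... | yes refl = Mij
  ... | no k≢j   = kept refl refl k≢j

  cutCol : (x ≡ k → y ≡ i → k ≢ i → relOf A k j) → y ≡ i → x ∈ [ k ] → relOf M x j
  cutCol kept refl (here refl) with k ≟ i
  ... | yes refl = Mij
  ... | no k≢i   = proj₁ (to inner (kept refl refl k≢i))

  sound : relOf (stepK i j M k) x y → Pruned [ k ] i j M x y
  sound Kxy = proj₁ (to inner Axy) , cutRow (proj₂ (to inner Axy)) , cutCol (proj₂ (to outer Kxy))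
    where
    Axy = proj₁ (to outer Kxy)

  complete : Pruned [ k ] i j M x y → relOf (stepK i j M k) x y
  complete (Mxy , cutRow , cutCol) = from outer (from inner (Mxy , keptRow) , keptCol)
    where
    keptRow : x ≡ j → y ≡ k → k ≢ j → relOf M i k
    keptRow refl refl _ = cutRow refl (here refl)
    keptCol : x ≡ k → y ≡ i → k ≢ i → relOf A k j
    keptCol refl refl _ = from inner (cutCol refl (here refl) , λ k≡j _ k≢j → ⊥-elim (k≢j k≡j))

kloop-spec : relOf M i j → ∀ ks {x y} → relOf (foldl (stepK i j) M ks) x y ⇔ Pruned ks i j M x y
kloop-spec Mij [] = mk⇔ (λ Mxy → Mxy , (λ _ ()) , (λ _ ())) proj₁
kloop-spec {M = M} {i} {j} Mij (k ∷ ks) {x} {y} = mk⇔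
  (λ K′xy → sound (to rest K′xy))
  (λ p → from rest (complete p))
  where
  M′ = stepK i j M k
  step : ∀ {x y} → relOf M′ x y ⇔ Pruned [ k ] i j M x y
  step = stepK-spec Mij k
  M′ij : relOf M′ i j
  M′ij = from step (pruned-row M Mij Mij)
  rest : relOf (foldl (stepK i j) M′ ks) x y ⇔ Pruned ks i j M′ x y
  rest = kloop-spec M′ij ks

  sound : Pruned ks i j M′ x y → Pruned (k ∷ ks) i j M x y
  sound (M′xy , cutRow , cutCol) = Mxy , cutRow′ , cutCol′
    where
    Mxy = proj₁ (to step M′xy)
    cutRow′ : x ≡ j → y ∈ k ∷ ks → relOf M i y
    cutRow′ x≡j (here y≡k)  = proj₁ (proj₂ (to step M′xy)) x≡j (here y≡k)
    cutRow′ x≡j (there y∈ks) = proj₁ (to step (cutRow x≡j y∈ks))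
    cutCol′ : y ≡ i → x ∈ k ∷ ks → relOf M x j
    cutCol′ y≡i (here x≡k)  = proj₂ (proj₂ (to step M′xy)) y≡i (here x≡k)
    cutCol′ y≡i (there x∈ks) = proj₁ (to step (cutCol y≡i x∈ks))

  complete : Pruned (k ∷ ks) i j M x y → Pruned ks i j M′ x y
  complete (Mxy , cutRow , cutCol) =
    from step (Mxy , (λ x≡j y∈k → cutRow x≡j (here-of y∈k)) , (λ y≡i x∈k → cutCol y≡i (here-of x∈k))) ,
    (λ x≡j y∈ks → from step (pruned-row M Mij (cutRow x≡j (there y∈ks)))) ,
    (λ y≡i x∈ks → from step (pruned-col M Mij (cutCol y≡i (there x∈ks))))
    where
    here-of : ∀ {z} → z ∈ [ k ] → z ∈ k ∷ ks
    here-of (here z≡k) = here z≡k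

ClosedAt : Matrix n → Rel (Fin n) 0ℓ
ClosedAt M a b = relOf M a b → (relOf M b ⊆ relOf M a) × ((λ k → relOf M k a) ⊆ (λ k → relOf M k b))

ClosedOn : Rel (Fin n) 0ℓ → Matrix n → Set
ClosedOn P M = P ⇒ ClosedAt M

closedAt-diagonal : ∀ {a} → ClosedAt M a a
closedAt-diagonal _ = (λ m → m) , (λ m → m)

Pair : Fin n → Fin n → Rel (Fin n) 0ℓ
Pair i j a b = a ≡ i × b ≡ j

Row : Fin n → Rel (Fin n) 0ℓ
Row i a _ = a ≡ i

FullRowsExcept : Fin n → Rel (Fin n) 0ℓ → Set
FullRowsExcept i P = ∀ {a b c} → P a b → a ≢ i → P a c

FullRows : Rel (Fin n) 0ℓ → Set
FullRows P = ∀ {a b c} → P a b → P a c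

-- P and P′ are the pairs processed before and after the run from M to M′.
record Progress (P P′ : Rel (Fin n) 0ℓ) (M M′ : Matrix n) : Set₁ where
  field
    grows   : P ⇒ P′
    closed  : ClosedOn P′ M′
    shrinks : relOf M′ ⇒ relOf M
    stable  : ∀ {a b} → P a b → relOf M a b → relOf M′ a b
    maximal : ∀ {β} → Transitive β → β ⇒ relOf M → (∀ {a b} → P′ a b → relOf M′ a b → β a b) → β ⇒ relOf M′

open Progress

Progress-idle : ∀ {P Q : Rel (Fin n) 0ℓ} → P ⇒ Q → ClosedOn Q M → Progress P Q M M
Progress-idle P⇒Q cl = record
  { grows = P⇒Q ; closed = cl ; shrinks = λ m → m ; stable = λ _ m → m ; maximal = λ _ β⇒M _ → β⇒M }

Progress-trans : ∀ {P Q R : Rel (Fin n) 0ℓ} {M M′ M″ : Matrix n} →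
  Progress P Q M M′ → Progress Q R M′ M″ → Progress P R M M″
Progress-trans p q = record
  { grows   = λ x → grows q (grows p x)
  ; closed  = closed q
  ; shrinks = λ m → shrinks p (shrinks q m)
  ; stable  = λ Pab Mab → stable q (grows p Pab) (stable p Pab Mab)
  ; maximal = λ tβ β⇒M settled →
      maximal q tβ (maximal p tβ β⇒M (λ Qab M′ab → settled (grows q Qab) (stable q Qab M′ab))) settled
  }

Progress-cong : ∀ {P Q Q′ : Rel (Fin n) 0ℓ} {M M′ : Matrix n} →
  Q ⇒ Q′ → Q′ ⇒ Q → Progress P Q M M′ → Progress P Q′ M M′
Progress-cong Q⇒Q′ Q′⇒Q p = record
  { grows   = λ x → Q⇒Q′ (grows p x)
  ; closed  = λ q → closed p (Q′⇒Q q)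
  ; shrinks = shrinks p
  ; stable  = stable p
  ; maximal = λ tβ β⇒M settled → maximal p tβ β⇒M (λ q → settled (Q⇒Q′ q))
  }

progress-foldl : ∀ {X : Set} (D : X → Rel (Fin n) 0ℓ) (f : Matrix n → X → Matrix n)
  (Inv : Rel (Fin n) 0ℓ → Set) →
  (∀ {P} x → Inv P → Inv (P ∪ D x)) →
  (∀ {P M} x → Inv P → ClosedOn P M → Progress P (P ∪ D x) M (f M x)) →
  ∀ xs {P M} → Inv P → ClosedOn P M → Progress P (adjoin D P xs) M (foldl f M xs)
progress-foldl D f Inv preserve step []       inv cl = Progress-idle (λ p → p) cl
progress-foldl D f Inv preserve step (x ∷ xs) inv cl =
  Progress-trans first (progress-foldl D f Inv preserve step xs (preserve x inv) (closed first))
  where first = step x inv cl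

pruning-progress : ∀ {P : Rel (Fin n) 0ℓ} → FullRowsExcept i P → ClosedOn P M → relOf M i j →
  (∀ {x y} → relOf K x y ⇔ Pruned (allFin n) i j M x y) → Progress P (P ∪ Pair i j) M K
pruning-progress {i = i} {M = M} {j = j} {K = K} {P = P} full cl Mij K⇔ = record
  { grows = inj₁ ; closed = closed′ ; shrinks = below ; stable = stable′ ; maximal = maximal′ }
  where
  below : relOf K ⇒ relOf M
  below Kxy = proj₁ (to K⇔ Kxy)

  rowJ : ∀ {y} → relOf K j y → relOf M i y
  rowJ {y} Kjy = proj₁ (proj₂ (to K⇔ Kjy)) refl (∈-allFin y)

  colI : ∀ {x} → relOf K x i → relOf M x j
  colI {x} Kxi = proj₂ (proj₂ (to K⇔ Kxi)) refl (∈-allFin x)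

  keep : ∀ {x y} → relOf M x y → (x ≡ j → relOf M i y) → (y ≡ i → relOf M x j) → relOf K x y
  keep Mxy cutRow cutCol = from K⇔ (Mxy , (λ x≡j _ → cutRow x≡j) , (λ y≡i _ → cutCol y≡i))

  Kij : relOf K i j
  Kij = keep Mij (λ _ → Mij) (λ _ → Mij)

  stable′ : ∀ {a b} → P a b → relOf M a b → relOf K a b
  stable′ Pab Mab = keep Mab (λ { refl → proj₂ (cl Pab Mab) Mij }) (λ { refl → proj₁ (cl Pab Mab) Mij })

  closed-old : ∀ {a b} → P a b → ClosedAt K a b
  closed-old {a} {b} Pab Kab = row , col
    where
    Mab = below Kab
    rowM = proj₁ (cl Pab Mab)
    colM = proj₂ (cl Pab Mab)
    row : relOf K b ⊆ relOf K a
    row Kbk with a ≟ i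
    ... | yes refl = keep (rowM (below Kbk)) (λ _ → rowM (below Kbk)) (λ _ → Mij)
    ... | no a≢i   = stable′ (full Pab a≢i) (rowM (below Kbk))
    col : (λ k → relOf K k a) ⊆ (λ k → relOf K k b)
    col Kka = keep (colM (below Kka)) (λ { refl → colM (rowJ Kka) }) toColJ
      where
      toColJ : b ≡ i → relOf M _ j
      toColJ refl with a ≟ i
      ... | yes refl = colI Kka
      ... | no a≢i   = proj₂ (cl (full Pab a≢i) (rowM Mij)) (below Kka)

  closed′ : ClosedOn (P ∪ Pair i j) K
  closed′ (inj₁ Pab)          = closed-old Pab
  closed′ (inj₂ (refl , refl)) _ =
    (λ Kjy → keep (rowJ Kjy) (λ _ → rowJ Kjy) (λ _ → Mij)) ,
    (λ Kxi → keep (colI Kxi) (λ _ → Mij) (λ _ → colI Kxi))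

  maximal′ : ∀ {β} → Transitive β → β ⇒ relOf M →
    (∀ {a b} → (P ∪ Pair i j) a b → relOf K a b → β a b) → β ⇒ relOf K
  maximal′ tβ β⇒M settled βxy =
    keep (β⇒M βxy) (λ { refl → β⇒M (tβ βij βxy) }) (λ { refl → β⇒M (tβ βxy βij) })
    where βij = settled (inj₂ (refl , refl)) Kij

closedOn-∪-Pair : ∀ {P : Rel (Fin n) 0ℓ} → ClosedOn P M → ClosedAt M i j → ClosedOn (P ∪ Pair i j) M
closedOn-∪-Pair cl _   (inj₁ Pab)          = cl Pab
closedOn-∪-Pair _  cij (inj₂ (refl , refl)) = cij

stepJ-progress : ∀ {P : Rel (Fin n) 0ℓ} → FullRowsExcept i P → ClosedOn P M →
  ∀ j → Progress P (P ∪ Pair i j) M (stepJ i M j)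
stepJ-progress {n = n} {i = i} {M = M} full cl j with j ≟ i | M i j in Mij
... | yes refl | _     = Progress-idle inj₁ (closedOn-∪-Pair cl (closedAt-diagonal {M = M}))
... | no _     | false = Progress-idle inj₁ (closedOn-∪-Pair cl λ Mij′ → ⊥-elim (not-¬ Mij′ Mij))
... | no _     | true  = pruning-progress full cl Mij (kloop-spec Mij (allFin n))

stepI-progress : ∀ {P : Rel (Fin n) 0ℓ} → FullRows P → ClosedOn P M →
  ∀ i → Progress P (P ∪ Row i) M (stepI M i)
stepI-progress {n = n} {P = P} full cl i =
  Progress-cong toRow fromRow
    (progress-foldl (Pair i) (stepJ i) (FullRowsExcept i) fullRowsExcept-∪
      (λ j full′ cl′ → stepJ-progress full′ cl′ j) (allFin n) (λ Pab _ → full Pab) cl)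
  where
  fullRowsExcept-∪ : ∀ {Q} j → FullRowsExcept i Q → FullRowsExcept i (Q ∪ Pair i j)
  fullRowsExcept-∪ _ full′ (inj₁ Qab)      a≢i = inj₁ (full′ Qab a≢i)
  fullRowsExcept-∪ _ _     (inj₂ (a≡i , _)) a≢i = ⊥-elim (a≢i a≡i)

  toRow : adjoin (Pair i) P (allFin n) ⇒ P ∪ Row i
  toRow = adjoin-⊆ (Pair i) inj₁ (λ _ (a≡i , _) → inj₂ a≡i) (allFin n)

  fromRow : P ∪ Row i ⇒ adjoin (Pair i) P (allFin n)
  fromRow (inj₁ Pab)       = adjoin-⊇ (Pair i) (allFin n) Pab
  fromRow {y = b} (inj₂ refl) = adjoin-∈ (Pair i) (∈-allFin b) (refl , refl)

lemma3 : (n : ℕ) (A : Matrix n) →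
    IsMaximalTransitiveIn (relOf (algorithm1 A)) (relOf A)
lemma3 n A = transitive , shrinks run , maximality
  where
  ∅ : Rel (Fin n) 0ℓ
  ∅ _ _ = ⊥

  run : Progress ∅ (adjoin Row ∅ (allFin n)) A (algorithm1 A)
  run = progress-foldl Row stepI FullRows fullRows-∪
          (λ i full cl → stepI-progress full cl i) (allFin n) (λ ()) (λ ())
    where
    fullRows-∪ : ∀ {P} i → FullRows P → FullRows (P ∪ Row i)
    fullRows-∪ _ full (inj₁ Pab)  = inj₁ (full Pab)
    fullRows-∪ _ _    (inj₂ a≡i) = inj₂ a≡i

  transitive : Transitive (relOf (algorithm1 A))
  transitive {a} Tab Tbc = proj₁ (closed run (adjoin-∈ Row (∈-allFin a) refl) Tab) Tbc

  maximality : ¬ Σ (Rel (Fin n) 0ℓ) λ β →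
    Transitive β × (relOf (algorithm1 A) ⇒ β) × ¬ (β ⇒ relOf (algorithm1 A)) × (β ⇒ relOf A)
  maximality (β , tβ , T⇒β , β⇏T , β⇒A) = β⇏T (maximal run tβ β⇒A (λ _ Tab → T⇒β Tab))
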